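{- Let $n$ be a nonnegative integer and $\delta\in\{1,2\}$. Suppose there exist a nonnegative integer $B$ and integers $x,y,z$ such that $$\frac{2n+(3\delta+4)B}{3}-(3\delta+4)B^2=x^2+2y^2+3\delta z^2+(x+2y+3\delta z)^2<(B+1)^2.$$ Then there exist nonnegative integers $w_0,x_0,y_0,z_0$ with $n=p_5(w_0)+p_5(x_0)+2p_5(y_0)+3\delta\,p_5(z_0)$, where $p_5(m)=m(3m-1)/2$.
   Context: The pentagonal numbers are $p_5(m)=m(3m-1)/2$ for $m\in\{0,1,2,\ldots\}$. -}

module Defs where

open import Data.Nat using (ℕ; _*_; _∸_; _/_)

-- pentagonal numbers p₅(m) = m(3m-1)/2  (m(3m-1) is always even, so ℕ-division is exact)
p5 : ℕ → ℕ
p5 m = (m * (3 * m ∸ 1)) / 2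

{-# OPTIONS --safe #-}
-- With s = x + 2y + cz, put w₀ = B + x, x₀ = B − s, y₀ = B + y, z₀ = B + z. Expanding
-- 2p₅(B + u) = 3B² − B + (6B − 1)u + 3u², the linear terms cancel since x − s + 2y + cz = 0, so
-- 2(p₅(w₀) + p₅(x₀) + 2p₅(y₀) + c p₅(z₀)) = (c + 4)(3B² − B) + 3(x² + 2y² + cz² + s²), which the
-- hypothesis identifies with 2n. The bound x² + 2y² + cz² + s² < (B + 1)² gives |u| ≤ B for all
-- four shifts, so w₀, x₀, y₀, z₀ are natural numbers.
module Submission where

open import Defs
open import Data.Nat using (ℕ; zero; suc)
import Data.Nat as ℕ
open import Data.Product using (_×_; _,_; ∃-syntax)
open import Data.Sum using (_⊎_; inj₁; inj₂)
open import Function using (_⟨_⟩_)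
open import Relation.Binary.PropositionalEquality
  using (_≡_; refl; sym; trans; cong; cong₂; subst; subst₂; module ≡-Reasoning)

module _ where
  open import Data.Nat
  open import Data.Nat.Properties
  open import Data.Nat.Divisibility using (_∣_; divides; ∣m∣n⇒∣m+n; m∣m*n)
  open import Data.Nat.DivMod using (m*[n/m]≡n)
  open import Data.Nat.Tactic.RingSolver using (solve-∀)

  2∣[1+k]*[2+3k] : ∀ k → 2 ∣ suc k * (2 + 3 * k)
  2∣[1+k]*[2+3k] zero    = divides 1 refl
  2∣[1+k]*[2+3k] (suc k) =
    subst (2 ∣_) (sym (step k)) (∣m∣n⇒∣m+n (2∣[1+k]*[2+3k] k) (m∣m*n (3 * k + 4)))
    where
    step : ∀ k → suc (suc k) * (2 + 3 * suc k) ≡ suc k * (2 + 3 * k) + 2 * (3 * k + 4)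
    step = solve-∀

  2∣m*[3m∸1] : ∀ m → 2 ∣ m * (3 * m ∸ 1)
  2∣m*[3m∸1] zero = divides 0 refl
  2∣m*[3m∸1] (suc k) =
    subst (λ t → 2 ∣ suc k * t) (sym (cong (_∸ 1) (*-suc 3 k))) (2∣[1+k]*[2+3k] k)

  2*p5≡m*[3m∸1] : ∀ m → 2 * p5 m ≡ m * (3 * m ∸ 1)
  2*p5≡m*[3m∸1] m = m*[n/m]≡n (2∣m*[3m∸1] m)

  squareSum : ℕ → ℕ → ℕ → ℕ → ℕ → ℕ
  squareSum c a b d e = a * a + 2 * (b * b) + c * (d * d) + e * e

  m*m<[n+1]²⇒m≤n : ∀ {m n} → m * m < (n + 1) * (n + 1) → m ≤ n
  m*m<[n+1]²⇒m≤n {n = n} m*m<[n+1]² rewrite +-comm n 1 =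
    ≮⇒≥ (λ n<m → <⇒≱ m*m<[n+1]² (*-mono-≤ n<m n<m))

  squareSum<[n+1]²⇒≤n : ∀ c .{{_ : NonZero c}} {a b d e n} →
    squareSum c a b d e < (n + 1) * (n + 1) → a ≤ n × b ≤ n × d ≤ n × e ≤ n
  squareSum<[n+1]²⇒≤n c {a} {b} {d} {e} {n} sum<[n+1]² =
      bound (m≤m+n (a * a) _ ⟨ ≤-trans ⟩ m≤m+n _ (c * (d * d)) ⟨ ≤-trans ⟩ m≤m+n _ (e * e))
    , bound (m≤n*m (b * b) 2 ⟨ ≤-trans ⟩ m≤n+m _ (a * a) ⟨ ≤-trans ⟩ m≤m+n _ (c * (d * d))
               ⟨ ≤-trans ⟩ m≤m+n _ (e * e))
    , bound (m≤n*m (d * d) c ⟨ ≤-trans ⟩ m≤n+m _ (a * a + 2 * (b * b)) ⟨ ≤-trans ⟩ m≤m+n _ (e * e))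
    , bound (m≤n+m (e * e) _)
    where
    bound : ∀ {m} → m * m ≤ squareSum c a b d e → m ≤ n
    bound m*m≤sum = m*m<[n+1]²⇒m≤n (≤-<-trans m*m≤sum sum<[n+1]²)

open import Data.Integer using (ℤ; +_; -[1+_]; -_; _+_; _-_; _*_; _<_; _⊖_; ∣_∣)
open import Data.Integer.Properties
  using (pos-*; ⊖-≥; m-n≡m⊖n; +◃n≡+n; ∣-i∣≡∣i∣; drop‿+<+; +-injective; *-cancelˡ-≡)
import Data.Integer.Tactic.RingSolver as ℤ-Solver

linearForm : ℤ → ℤ → ℤ → ℤ → ℤ
linearForm c x y z = x + + 2 * y + c * z

quadraticForm : ℤ → ℤ → ℤ → ℤ → ℤ
quadraticForm c x y z =
  x * x + + 2 * (y * y) + c * (z * z) + linearForm c x y z * linearForm c x y z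

twicePentagonal : ℤ → ℤ
twicePentagonal u = u * (+ 3 * u - + 1)

+2*+p5≡twicePentagonal : ∀ m → + 2 * + p5 m ≡ twicePentagonal (+ m)
+2*+p5≡twicePentagonal zero      = refl
+2*+p5≡twicePentagonal m@(suc k) = begin
  + 2 * + p5 m                  ≡⟨ pos-* 2 (p5 m) ⟨
  + (2 ℕ.* p5 m)                ≡⟨ cong +_ (2*p5≡m*[3m∸1] m) ⟩
  + (m ℕ.* (3 ℕ.* m ℕ.∸ 1))    ≡⟨ pos-* m _ ⟩
  + m * + (3 ℕ.* m ℕ.∸ 1)      ≡⟨ cong (+ m *_) (⊖-≥ (ℕ.s≤s ℕ.z≤n)) ⟨
  + m * (3 ℕ.* m ⊖ 1)          ≡⟨ cong (+ m *_) (m-n≡m⊖n (3 ℕ.* m) 1) ⟨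
  + m * (+ (3 ℕ.* m) - + 1)     ≡⟨ cong (λ t → + m * (t - + 1)) (pos-* 3 m) ⟩
  + m * (+ 3 * + m - + 1)       ∎
  where open ≡-Reasoning

i*i≡+∣i∣*∣i∣ : ∀ i → i * i ≡ + (∣ i ∣ ℕ.* ∣ i ∣)
i*i≡+∣i∣*∣i∣ (+ k)     = +◃n≡+n _
i*i≡+∣i∣*∣i∣ -[1+ k ]  = +◃n≡+n _

quadraticForm≡+squareSum : ∀ c x y z → let s = linearForm (+ c) x y z in
  quadraticForm (+ c) x y z ≡ + squareSum c (∣ x ∣) (∣ y ∣) (∣ z ∣) (∣ s ∣)
quadraticForm≡+squareSum c x y z = begin
  x * x + + 2 * (y * y) + + c * (z * z) + s * s
    ≡⟨ cong₂ _+_ (cong₂ _+_ (cong₂ _+_ (i*i≡+∣i∣*∣i∣ x) (cong (+ 2 *_) (i*i≡+∣i∣*∣i∣ y)))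
                              (cong (+ c *_) (i*i≡+∣i∣*∣i∣ z)))
                 (i*i≡+∣i∣*∣i∣ s) ⟩
  + (∣ x ∣ ℕ.* ∣ x ∣) + + 2 * + (∣ y ∣ ℕ.* ∣ y ∣) + + c * + (∣ z ∣ ℕ.* ∣ z ∣) + + (∣ s ∣ ℕ.* ∣ s ∣)
    ≡⟨ cong₂ (λ u v → + (∣ x ∣ ℕ.* ∣ x ∣) + u + v + + (∣ s ∣ ℕ.* ∣ s ∣))
             (pos-* 2 (∣ y ∣ ℕ.* ∣ y ∣)) (pos-* c (∣ z ∣ ℕ.* ∣ z ∣)) ⟨
  + squareSum c (∣ x ∣) (∣ y ∣) (∣ z ∣) (∣ s ∣) ∎
  where
  s = linearForm (+ c) x y z
  open ≡-Reasoning

quadraticForm<[n+1]²⇒∣·∣≤n : ∀ c .{{_ : ℕ.NonZero c}} {n} x y z →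
  quadraticForm (+ c) x y z < (+ n + + 1) * (+ n + + 1) →
  ∣ x ∣ ℕ.≤ n × ∣ y ∣ ℕ.≤ n × ∣ z ∣ ℕ.≤ n × ∣ linearForm (+ c) x y z ∣ ℕ.≤ n
quadraticForm<[n+1]²⇒∣·∣≤n c {n} x y z Q<[n+1]² = squareSum<[n+1]²⇒≤n c (drop‿+<+
  (subst₂ _<_ (quadraticForm≡+squareSum c x y z) (sym (pos-* (n ℕ.+ 1) (n ℕ.+ 1))) Q<[n+1]²))

∣i∣≤n⇒∃[m]+m≡+n+i : ∀ {n} i → ∣ i ∣ ℕ.≤ n → ∃[ m ] + m ≡ + n + i
∣i∣≤n⇒∃[m]+m≡+n+i (+ k)     _     = _ , refl
∣i∣≤n⇒∃[m]+m≡+n+i -[1+ k ]  1+k≤n = _ , sym (⊖-≥ 1+k≤n)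

-- Stated unfolded, since the ring solver does not see through twicePentagonal or quadraticForm.
shifted-twicePentagonal-sum : ∀ c b x y z →
  let s = x + + 2 * y + c * z
      P = λ u → u * (+ 3 * u - + 1) in
  P (b + x) + P (b - s) + + 2 * P (b + y) + c * P (b + z)
    ≡ (c + + 4) * (+ 3 * (b * b) - b) + + 3 * (x * x + + 2 * (y * y) + c * (z * z) + s * s)
shifted-twicePentagonal-sum = ℤ-Solver.solve-∀

a+kb-3kb²≡e⇒a≡k[3b²-b]+e : ∀ {a e} k b →
  a + k * b - + 3 * (k * (b * b)) ≡ e → a ≡ k * (+ 3 * (b * b) - b) + e
a+kb-3kb²≡e⇒a≡k[3b²-b]+e {a} k b eq =
  trans (regroup a k b) (cong (_+_ (k * (+ 3 * (b * b) - b))) eq)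
  where
  regroup : ∀ a k b → a ≡ k * (+ 3 * (b * b) - b) + (a + k * b - + 3 * (k * (b * b)))
  regroup = ℤ-Solver.solve-∀

twicePentagonal-sum≡+2*+p5-sum : ∀ c a b d e →
  twicePentagonal (+ a) + twicePentagonal (+ b) + + 2 * twicePentagonal (+ d)
    + + c * twicePentagonal (+ e)
  ≡ + 2 * + (p5 a ℕ.+ p5 b ℕ.+ 2 ℕ.* p5 d ℕ.+ c ℕ.* p5 e)
twicePentagonal-sum≡+2*+p5-sum c a b d e = begin
  twicePentagonal (+ a) + twicePentagonal (+ b) + + 2 * twicePentagonal (+ d)
    + + c * twicePentagonal (+ e)
    ≡⟨ cong₂ _+_ (cong₂ _+_ (cong₂ _+_ (+2*+p5≡twicePentagonal a) (+2*+p5≡twicePentagonal b))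
                              (cong (+ 2 *_) (+2*+p5≡twicePentagonal d)))
                 (cong (+ c *_) (+2*+p5≡twicePentagonal e)) ⟨
  + 2 * + p5 a + + 2 * + p5 b + + 2 * (+ 2 * + p5 d) + + c * (+ 2 * + p5 e)
    ≡⟨ factor (+ p5 a) (+ p5 b) (+ p5 d) (+ p5 e) (+ c) ⟩
  + 2 * (+ p5 a + + p5 b + + 2 * + p5 d + + c * + p5 e)
    ≡⟨ cong₂ (λ u v → + 2 * (+ p5 a + + p5 b + u + v)) (pos-* 2 (p5 d)) (pos-* c (p5 e)) ⟨
  + 2 * + (p5 a ℕ.+ p5 b ℕ.+ 2 ℕ.* p5 d ℕ.+ c ℕ.* p5 e) ∎
  where
  open ≡-Reasoning
  factor : ∀ a b d e c →
    + 2 * a + + 2 * b + + 2 * (+ 2 * d) + c * (+ 2 * e) ≡ + 2 * (a + b + + 2 * d + c * e)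
  factor = ℤ-Solver.solve-∀

pentagonal-representation : ∀ c .{{_ : ℕ.NonZero c}} n B x y z →
  + 2 * + n + (+ c + + 4) * + B - + 3 * ((+ c + + 4) * (+ B * + B))
    ≡ + 3 * quadraticForm (+ c) x y z →
  quadraticForm (+ c) x y z < (+ B + + 1) * (+ B + + 1) →
  ∃[ w₀ ] ∃[ x₀ ] ∃[ y₀ ] ∃[ z₀ ] n ≡ p5 w₀ ℕ.+ p5 x₀ ℕ.+ 2 ℕ.* p5 y₀ ℕ.+ c ℕ.* p5 z₀
pentagonal-representation c n B x y z eq Q<[B+1]²
  with ∣x∣≤B , ∣y∣≤B , ∣z∣≤B , ∣s∣≤B ← quadraticForm<[n+1]²⇒∣·∣≤n c x y z Q<[B+1]²
  with w₀ , +w₀≡B+x ← ∣i∣≤n⇒∃[m]+m≡+n+i x ∣x∣≤B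
     | x₀ , +x₀≡B-s ← ∣i∣≤n⇒∃[m]+m≡+n+i (- linearForm (+ c) x y z)
                         (subst (ℕ._≤ B) (sym (∣-i∣≡∣i∣ (linearForm (+ c) x y z))) ∣s∣≤B)
     | y₀ , +y₀≡B+y ← ∣i∣≤n⇒∃[m]+m≡+n+i y ∣y∣≤B
     | z₀ , +z₀≡B+z ← ∣i∣≤n⇒∃[m]+m≡+n+i z ∣z∣≤B
  = w₀ , x₀ , y₀ , z₀ , +-injective (*-cancelˡ-≡ (+ 2) (+ n) _ (begin
    + 2 * + n
      ≡⟨ a+kb-3kb²≡e⇒a≡k[3b²-b]+e (+ c + + 4) (+ B) eq ⟩
    (+ c + + 4) * (+ 3 * (+ B * + B) - + B) + + 3 * quadraticForm (+ c) x y z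
      ≡⟨ shifted-twicePentagonal-sum (+ c) (+ B) x y z ⟨
    P (+ B + x) + P (+ B - s) + + 2 * P (+ B + y) + + c * P (+ B + z)
      ≡⟨ cong₂ _+_ (cong₂ _+_ (cong₂ _+_ (cong P +w₀≡B+x) (cong P +x₀≡B-s))
                                (cong (λ u → + 2 * P u) +y₀≡B+y))
                   (cong (λ u → + c * P u) +z₀≡B+z) ⟨
    P (+ w₀) + P (+ x₀) + + 2 * P (+ y₀) + + c * P (+ z₀)
      ≡⟨ twicePentagonal-sum≡+2*+p5-sum c w₀ x₀ y₀ z₀ ⟩
    + 2 * + (p5 w₀ ℕ.+ p5 x₀ ℕ.+ 2 ℕ.* p5 y₀ ℕ.+ c ℕ.* p5 z₀) ∎))
  where
  s = linearForm (+ c) x y z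
  P = twicePentagonal
  open ≡-Reasoning

lemma4p2 : (n δ : ℕ) → (δ ≡ 1 ⊎ δ ≡ 2) →
    (∃[ B ] ∃[ x ] ∃[ y ] ∃[ z ]
      ((+ 2 * + n + (+ 3 * + δ + + 4) * + B - + 3 * ((+ 3 * + δ + + 4) * (+ B * + B))
          ≡ + 3 * (x * x + + 2 * (y * y) + + 3 * + δ * (z * z)
                   + (x + + 2 * y + + 3 * + δ * z) * (x + + 2 * y + + 3 * + δ * z)))
       × (x * x + + 2 * (y * y) + + 3 * + δ * (z * z)
            + (x + + 2 * y + + 3 * + δ * z) * (x + + 2 * y + + 3 * + δ * z)
          < (+ B + + 1) * (+ B + + 1)))) →
    ∃[ w₀ ] ∃[ x₀ ] ∃[ y₀ ] ∃[ z₀ ]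
      (n ≡ Data.Nat._+_ (Data.Nat._+_ (Data.Nat._+_ (p5 w₀) (p5 x₀)) (Data.Nat._*_ 2 (p5 y₀)))
                        (Data.Nat._*_ (Data.Nat._*_ 3 δ) (p5 z₀)))
lemma4p2 n .1 (inj₁ refl) (B , x , y , z , eq , Q<[B+1]²) =
  pentagonal-representation 3 n B x y z eq Q<[B+1]²
lemma4p2 n .2 (inj₂ refl) (B , x , y , z , eq , Q<[B+1]²) =
  pentagonal-representation 6 n B x y z eq Q<[B+1]²
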